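{- Let $1 \le t_1 < t_2 < n$ be integers with $n \ge t_1 + t_2$, let $G = G_n\langle t_1, t_2\rangle$ and $d = \gcd(t_1, t_2)$. Then the following statements are equivalent: (i) $(t_1+t_2)/d$ is even or $(t_1+t_2)/d = 3$; (ii) $G$ is odd-hole-free; (iii) $G$ is perfect; (iv) $G$ is weakly perfect.
   Context: For integers $1 \le t_1 < \cdots < t_k < n$, the Toeplitz graph $G_n\langle t_1, \ldots, t_k\rangle$ is the simple graph with vertex set $\{1, \ldots, n\}$ in which distinct vertices $i, j$ are adjacent iff $|i-j| \in \{t_1, \ldots, t_k\}$. A hole is an induced cycle of length at least $4$; an odd hole is a hole with an odd number of vertices. A graph is perfect if every induced subgraph $H$ satisfies $\omega(H) = \chi(H)$ (clique number equals chromatic number), and weakly perfect if $\omega(G) = \chi(G)$. -}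

module Defs where

open import Data.Nat using (ℕ; zero; suc; _+_; _*_; _≤_; _<_; ∣_-_∣)
open import Data.Nat.Divisibility using (_∣_)
open import Data.Nat.GCD using (gcd)
open import Data.Fin using (Fin; toℕ)
open import Data.Fin.Subset using (Subset; _∈_; ⊤)
open import Data.Product using (Σ; ∃; _×_; _,_)
open import Data.Sum using (_⊎_)
open import Relation.Nullary using (¬_)
open import Relation.Binary.PropositionalEquality using (_≡_; _≢_)
open import Function.Definitions using (Injective)

Graph : ℕ → Set₁
Graph n = Fin n → Fin n → Set

-- Toeplitz graph G_n⟨t₁,t₂⟩.  Vertex i : Fin n stands for the integer
-- toℕ i + 1 ∈ {1,…,n}; distinct vertices i, j are adjacent iff
-- |i - j| ∈ {t₁, t₂}.
label : ∀ {n} → Fin n → ℕ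
label i = suc (toℕ i)

Toeplitz₂ : (n t₁ t₂ : ℕ) → Graph n
Toeplitz₂ n t₁ t₂ i j =
  (i ≢ j) × (∣ label i - label j ∣ ≡ t₁ ⊎ ∣ label i - label j ∣ ≡ t₂)

IsCliqueOfSize : ∀ {n} → Graph n → Subset n → ℕ → Set
IsCliqueOfSize {n} G S k =
  Σ (Fin k → Fin n) λ f →
    Injective _≡_ _≡_ f × (∀ a → f a ∈ S) × (∀ a b → a ≢ b → G (f a) (f b))

IsCliqueNumber : ∀ {n} → Graph n → Subset n → ℕ → Set
IsCliqueNumber G S w =
  IsCliqueOfSize G S w × (∀ k → IsCliqueOfSize G S k → k ≤ w)

IsColouring : ∀ {n} → Graph n → Subset n → ℕ → Set
IsColouring {n} G S k =
  Σ (Fin n → ℕ) λ c →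
    (∀ v → v ∈ S → c v < k) ×
    (∀ u v → u ∈ S → v ∈ S → G u v → c u ≢ c v)

IsChromaticNumber : ∀ {n} → Graph n → Subset n → ℕ → Set
IsChromaticNumber G S x =
  IsColouring G S x × (∀ k → IsColouring G S k → x ≤ k)

CliqueEqChromatic : ∀ {n} → Graph n → Subset n → Set
CliqueEqChromatic G S = ∃ λ k → IsCliqueNumber G S k × IsChromaticNumber G S k

WeaklyPerfect : ∀ {n} → Graph n → Set
WeaklyPerfect G = CliqueEqChromatic G ⊤

Perfect : ∀ {n} → Graph n → Set
Perfect {n} G = (S : Subset n) → CliqueEqChromatic G S

CycSucc : ∀ {m} → Fin m → Fin m → Set
CycSucc {m} i j = (suc (toℕ i) ≡ toℕ j) ⊎ (suc (toℕ i) ≡ m × toℕ j ≡ 0)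

CycAdj : ∀ {m} → Fin m → Fin m → Set
CycAdj i j = CycSucc i j ⊎ CycSucc j i

IsHole : ∀ {n} → Graph n → (m : ℕ) → (Fin m → Fin n) → Set
IsHole {n} G m v =
  4 ≤ m × Injective _≡_ _≡_ v ×
  (∀ i j → (G (v i) (v j) → CycAdj i j) × (CycAdj i j → G (v i) (v j)))

OddHoleFree : ∀ {n} → Graph n → Set
OddHoleFree {n} G = ∀ m (v : Fin m → Fin n) → ¬ (2 ∣ m) → ¬ IsHole G m v

QuotCond : ℕ → ℕ → Set
QuotCond t₁ t₂ = ∃ λ q → (t₁ + t₂ ≡ gcd t₁ t₂ * q) × (2 ∣ q ⊎ q ≡ 3)

-- Write d = gcd t₁ t₂, t₁ = a·d, t₂ = b·d and q = a + b, so that a and b are coprime.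
-- If q is even then a and b are odd, and colouring x by the parity of ⌊x/d⌋ is proper.
-- If q = 3 then (t₁, t₂) = (d, 2d): ⌊x/d⌋ mod 3 is a proper 3-colouring, and a triangle-free
-- vertex set is 2-colourable, since in each class mod d it has no three consecutive members.
-- A 3-colourable graph whose triangle-free induced subgraphs are bipartite is perfect and
-- odd-hole-free.  Otherwise q ≥ 5 is odd, and the q vertices at positions d·(i·a mod q) form an
-- odd hole: consecutive ones differ by a·d or b·d, and a, being invertible mod q, makes the
-- "differ by t₁ or t₂" relation exactly the cyclic order.  A triangle would force t₂ = 2t₁, hence
-- q = 3, so ω = 2 while the odd hole needs 3 colours.

module Submission where

open import Defs
open import Data.Nat using (ℕ; zero; suc; _+_; _*_; _∸_; _≤_; _<_; z≤n; s≤s; ∣_-_∣; NonZero; _/_; _%_; _≟_; _<?_)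
open import Data.Nat.Base using (>-nonZero; >-nonZero⁻¹; ≢-nonZero)
open import Data.Nat.Properties
open import Data.Nat.DivMod
open import Data.Nat.Divisibility
open import Data.Nat.GCD using (gcd; gcd[m,n]∣m; gcd[m,n]∣n; gcd[m,n]≢0)
open import Data.Nat.Coprimality using (Coprime; coprime-/gcd; coprime-divisor)
open import Data.Fin as Fin using (Fin; zero; suc; toℕ; fromℕ<)
import Data.Fin.Properties as Fin
open import Data.Fin.Subset using (_∈_; ⊤)
open import Data.Fin.Subset.Properties using (_∈?_; ∈⊤)
open import Data.Product as Product using (Σ; ∃; _×_; _,_; proj₁; proj₂)
open import Data.Sum as Sum using (_⊎_; inj₁; inj₂; [_,_])
open import Data.Empty using (⊥; ⊥-elim)
open import Relation.Nullary using (¬_; Dec; yes; no; contradiction)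
open import Relation.Nullary.Decidable using (_×-dec_; _⊎-dec_; ¬?)
open import Relation.Unary using (Decidable; U)
open import Relation.Binary.PropositionalEquality
  using (_≡_; _≢_; refl; sym; trans; cong; cong₂; subst; subst₂; ≢-sym; module ≡-Reasoning)
open import Function.Definitions using (Injective)
open import Function.Base using (_∘_)
open import Function.Bundles using (_⇔_; mk⇔; module Equivalence)
open import Algebra.Properties.CommutativeSemigroup +-commutativeSemigroup using (x∙yz≈xz∙y)

-- Arithmetic modulo d

[m%d≡n%d]⇒d∣n∸m : ∀ {m n d} .{{_ : NonZero d}} → m % d ≡ n % d → d ∣ n ∸ m
[m%d≡n%d]⇒d∣n∸m {m} {n} {d} eq = divides (n / d ∸ m / d) (begin
  n ∸ m                                     ≡⟨ cong₂ _∸_ (m≡m%n+[m/n]*n n d) (m≡m%n+[m/n]*n m d) ⟩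
  (n % d + n / d * d) ∸ (m % d + m / d * d) ≡⟨ cong (λ r → (n % d + n / d * d) ∸ (r + m / d * d)) eq ⟩
  (n % d + n / d * d) ∸ (n % d + m / d * d) ≡⟨ [m+n]∸[m+o]≡n∸o (n % d) (n / d * d) (m / d * d) ⟩
  n / d * d ∸ m / d * d                     ≡⟨ *-distribʳ-∸ d (n / d) (m / d) ⟨
  (n / d ∸ m / d) * d                       ∎)
  where open ≡-Reasoning

[k+m]%d≡m%d⇒d∣k : ∀ k m {d} .{{_ : NonZero d}} → (k + m) % d ≡ m % d → d ∣ k
[k+m]%d≡m%d⇒d∣k k m {d} eq = subst (d ∣_) (m+n∸n≡m k m) ([m%d≡n%d]⇒d∣n∸m (sym eq))

[k+m]%d≢m%d : ∀ {k} m {d} .{{_ : NonZero d}} → ¬ d ∣ k → (k + m) % d ≢ m % d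
[k+m]%d≢m%d {k} m d∤k eq = d∤k ([k+m]%d≡m%d⇒d∣k k m eq)

[1+m]%2≢m%2 : ∀ m → suc m % 2 ≢ m % 2
[1+m]%2≢m%2 m = [k+m]%d≢m%d m λ 2∣1 → contradiction (∣1⇒≡1 2∣1) λ ()

[m+kd]/d≡k+m/d : ∀ m k d .{{_ : NonZero d}} → (m + k * d) / d ≡ k + m / d
[m+kd]/d≡k+m/d m k d =
  trans (+-distrib-/-∣ʳ m (n∣m*n k)) (trans (cong (m / d +_) (m*n/n≡m k d)) (+-comm (m / d) k))

[m%d+n]%d≡[m+n]%d : ∀ m n d .{{_ : NonZero d}} → (m % d + n) % d ≡ (m + n) % d
[m%d+n]%d≡[m+n]%d m n d = begin
  (m % d + n) % d         ≡⟨ %-distribˡ-+ (m % d) n d ⟩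
  (m % d % d + n % d) % d ≡⟨ cong (λ r → (r + n % d) % d) (m%n%n≡m%n m d) ⟩
  (m % d + n % d) % d     ≡⟨ %-distribˡ-+ m n d ⟨
  (m + n) % d             ∎
  where open ≡-Reasoning

%-congʳ-* : ∀ {m n} k d .{{_ : NonZero d}} → m % d ≡ n % d → (m * k) % d ≡ (n * k) % d
%-congʳ-* {m} {n} k d eq =
  trans (%-distribˡ-* m k d) (trans (cong (λ r → (r * (k % d)) % d) eq) (sym (%-distribˡ-* n k d)))

%-cancelʳ-*-≤ : ∀ {m n k d} .{{_ : NonZero d}} → Coprime d k → m ≤ n →
                (m * k) % d ≡ (n * k) % d → m % d ≡ n % d
%-cancelʳ-*-≤ {m} {n} {k} {d} cop m≤n eq = begin
  m % d             ≡⟨ %-remove-+ʳ m d∣n∸m ⟨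
  (m + (n ∸ m)) % d ≡⟨ cong (_% d) (m+[n∸m]≡n m≤n) ⟩
  n % d             ∎
  where
  open ≡-Reasoning
  d∣n∸m : d ∣ n ∸ m
  d∣n∸m = coprime-divisor cop (subst (d ∣_) (trans (sym (*-distribʳ-∸ k n m)) (*-comm (n ∸ m) k))
                                              ([m%d≡n%d]⇒d∣n∸m eq))

%-cancelʳ-* : ∀ {m n k d} .{{_ : NonZero d}} → Coprime d k → (m * k) % d ≡ (n * k) % d → m % d ≡ n % d
%-cancelʳ-* {m} {n} cop eq with ≤-total m n
... | inj₁ m≤n = %-cancelʳ-*-≤ cop m≤n eq
... | inj₂ n≤m = sym (%-cancelʳ-*-≤ cop n≤m (sym eq))

y≡[x+a]%[a+b]⇒y≡x+a⊎y+b≡x : ∀ {a b x y} .{{_ : NonZero (a + b)}} → x < a + b → y < a + b →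
            y ≡ (x + a) % (a + b) → y ≡ x + a ⊎ y + b ≡ x
y≡[x+a]%[a+b]⇒y≡x+a⊎y+b≡x {a} {b} {x} {y} x<q y<q y≡ with x + a <? a + b
... | yes x+a<q = inj₁ (trans y≡ (m<n⇒m%n≡m x+a<q))
... | no x+a≮q = inj₂ (begin
  y + b                           ≡⟨ cong (_+ b) y≡ ⟩
  (x + a) % (a + b) + b           ≡⟨ cong (λ z → z % (a + b) + b) x+a≡ ⟩
  (x ∸ b + (a + b)) % (a + b) + b ≡⟨ cong (_+ b) ([m+n]%n≡m%n (x ∸ b) (a + b)) ⟩
  (x ∸ b) % (a + b) + b           ≡⟨ cong (_+ b) (m<n⇒m%n≡m (≤-<-trans (m∸n≤m x b) x<q)) ⟩
  x ∸ b + b                       ≡⟨ m∸n+n≡m b≤x ⟩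
  x                               ∎)
  where
  open ≡-Reasoning
  b≤x : b ≤ x
  b≤x = +-cancelˡ-≤ a b x (subst (a + b ≤_) (+-comm x a) (≮⇒≥ x+a≮q))
  x+a≡ : x + a ≡ x ∸ b + (a + b)
  x+a≡ = begin
    x + a           ≡⟨ cong (_+ a) (m∸n+n≡m b≤x) ⟨
    x ∸ b + b + a   ≡⟨ +-assoc (x ∸ b) b a ⟩
    x ∸ b + (b + a) ≡⟨ cong (x ∸ b +_) (+-comm b a) ⟩
    x ∸ b + (a + b) ∎

y≡x+a⊎y+b≡x⇒y≡[x+a]%[a+b] : ∀ {a b x y} .{{_ : NonZero (a + b)}} → y < a + b →
              y ≡ x + a ⊎ y + b ≡ x → y ≡ (x + a) % (a + b)
y≡x+a⊎y+b≡x⇒y≡[x+a]%[a+b] y<q (inj₁ refl) = sym (m<n⇒m%n≡m y<q)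
y≡x+a⊎y+b≡x⇒y≡[x+a]%[a+b] {a} {b} {y = y} y<q (inj₂ refl) = sym (begin
  (y + b + a) % (a + b)   ≡⟨ cong (_% (a + b)) (trans (+-assoc y b a) (cong (y +_) (+-comm b a))) ⟩
  (y + (a + b)) % (a + b) ≡⟨ [m+n]%n≡m%n y (a + b) ⟩
  y % (a + b)             ≡⟨ m<n⇒m%n≡m y<q ⟩
  y                       ∎)
  where open ≡-Reasoning

both≢⇒≡ : ∀ {x y z} → x < 2 → y < 2 → z < 2 → x ≢ z → y ≢ z → x ≡ y
both≢⇒≡ {0} {0} _ _ _ _ _ = refl
both≢⇒≡ {1} {1} _ _ _ _ _ = refl
both≢⇒≡ {0} {1} {0} _ _ _ x≢z _ = contradiction refl x≢z
both≢⇒≡ {0} {1} {1} _ _ _ _ y≢z = contradiction refl y≢z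
both≢⇒≡ {1} {0} {0} _ _ _ _ y≢z = contradiction refl y≢z
both≢⇒≡ {1} {0} {1} _ _ _ x≢z _ = contradiction refl x≢z
both≢⇒≡ {suc (suc _)} (s≤s (s≤s ()))
both≢⇒≡ {y = suc (suc _)} _ (s≤s (s≤s ()))
both≢⇒≡ {z = suc (suc _)} _ _ (s≤s (s≤s ()))

-- Colourings and triangles

module _ {n : ℕ} (G : Graph n) where

  -- A colouring of the induced subgraph G[P]; IsColouring G S k is Colouring G (_∈ S) k.
  Colouring : (Fin n → Set) → ℕ → Set
  Colouring P k = Σ (Fin n → ℕ) λ c → (∀ v → P v → c v < k) × (∀ u v → P u → P v → G u v → c u ≢ c v)

  Edge : (Fin n → Set) → Set
  Edge P = Σ (Fin n) λ u → Σ (Fin n) λ v → P u × P v × G u v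

  Triangle : (Fin n → Set) → Set
  Triangle P = Σ (Fin n) λ u → Σ (Fin n) λ v → Σ (Fin n) λ w →
               P u × P v × P w × G u v × G u w × G v w

  TriangleFree : Set
  TriangleFree = ∀ {u v w} → G u v → G u w → G v w → ⊥

  TriangleFreeBipartite : Set₁
  TriangleFreeBipartite = ∀ P → Decidable P → ¬ Triangle P → Colouring P 2

-- Cycles

-- CycSucc {m} i j unfolds to SuccMod m (toℕ i) (toℕ j).
SuccMod : ℕ → ℕ → ℕ → Set
SuccMod m x y = suc x ≡ y ⊎ (suc x ≡ m × y ≡ 0)

SuccMod-no-3-cycle : ∀ {m x y z} → 4 ≤ m → SuccMod m x y → SuccMod m y z → SuccMod m z x → ⊥
SuccMod-no-3-cycle _ (inj₁ refl) (inj₁ refl) (inj₁ ())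
SuccMod-no-3-cycle (s≤s (s≤s (s≤s ()))) (inj₂ (refl , refl)) (inj₁ refl) (inj₁ refl)
SuccMod-no-3-cycle (s≤s (s≤s (s≤s ()))) (inj₁ refl) (inj₂ (refl , refl)) (inj₁ refl)
SuccMod-no-3-cycle (s≤s (s≤s (s≤s ()))) (inj₁ refl) (inj₁ refl) (inj₂ (refl , refl))

module _ {m : ℕ} where

  CycSucc-functional : ∀ {i j k : Fin m} → CycSucc i j → CycSucc i k → j ≡ k
  CycSucc-functional (inj₁ i→j) (inj₁ i→k) = Fin.toℕ-injective (trans (sym i→j) i→k)
  CycSucc-functional {j = j} (inj₁ i→j) (inj₂ (1+i≡m , _)) = contradiction (trans (sym i→j) 1+i≡m) (<⇒≢ (Fin.toℕ<n j))
  CycSucc-functional {k = k} (inj₂ (1+i≡m , _)) (inj₁ i→k) = contradiction (trans (sym i→k) 1+i≡m) (<⇒≢ (Fin.toℕ<n k))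
  CycSucc-functional (inj₂ (_ , j≡0)) (inj₂ (_ , k≡0)) = Fin.toℕ-injective (trans j≡0 (sym k≡0))

  CycSucc-injective : ∀ {i j k : Fin m} → CycSucc j i → CycSucc k i → j ≡ k
  CycSucc-injective (inj₁ j→i) (inj₁ k→i) = Fin.toℕ-injective (suc-injective (trans j→i (sym k→i)))
  CycSucc-injective (inj₁ j→i) (inj₂ (_ , i≡0)) = contradiction (trans j→i i≡0) λ ()
  CycSucc-injective (inj₂ (_ , i≡0)) (inj₁ k→i) = contradiction (trans k→i i≡0) λ ()
  CycSucc-injective (inj₂ (1+j≡m , _)) (inj₂ (1+k≡m , _)) = Fin.toℕ-injective (suc-injective (trans 1+j≡m (sym 1+k≡m)))

  -- No vertex has two successors or two predecessors, so a triangle would be a directed 3-cycle.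
  cycle-triangle-free : ∀ {i j k : Fin m} → 4 ≤ m → i ≢ k → j ≢ k → CycAdj i j → CycAdj i k → CycAdj j k → ⊥
  cycle-triangle-free _ _ j≢k (inj₁ i→j) (inj₁ i→k) _ = j≢k (CycSucc-functional i→j i→k)
  cycle-triangle-free _ _ j≢k (inj₂ j→i) (inj₂ k→i) _ = j≢k (CycSucc-injective j→i k→i)
  cycle-triangle-free 4≤m _ _ (inj₁ i→j) (inj₂ k→i) (inj₁ j→k) = SuccMod-no-3-cycle 4≤m i→j j→k k→i
  cycle-triangle-free _ i≢k _ (inj₁ i→j) (inj₂ k→i) (inj₂ k→j) = i≢k (CycSucc-injective i→j k→j)
  cycle-triangle-free _ i≢k _ (inj₂ j→i) (inj₁ i→k) (inj₁ j→k) = i≢k (CycSucc-functional j→i j→k)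
  cycle-triangle-free 4≤m _ _ (inj₂ j→i) (inj₁ i→k) (inj₂ k→j) = SuccMod-no-3-cycle 4≤m i→k k→j j→i

module _ {m : ℕ} .{{_ : NonZero m}} {i j : Fin m} where

  CycSucc⇒≡suc-mod : CycSucc i j → toℕ j ≡ suc (toℕ i) % m
  CycSucc⇒≡suc-mod (inj₁ i→j) = sym (trans (cong (_% m) i→j) (m<n⇒m%n≡m (Fin.toℕ<n j)))
  CycSucc⇒≡suc-mod (inj₂ (1+i≡m , j≡0)) = trans j≡0 (sym (trans (cong (_% m) 1+i≡m) (n%n≡0 m)))

  ≡suc-mod⇒CycSucc : toℕ j ≡ suc (toℕ i) % m → CycSucc i j
  ≡suc-mod⇒CycSucc j≡ with m≤n⇒m<n∨m≡n (Fin.toℕ<n i)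
  ... | inj₁ 1+i<m = inj₁ (sym (trans j≡ (m<n⇒m%n≡m 1+i<m)))
  ... | inj₂ 1+i≡m = inj₂ (1+i≡m , trans j≡ (trans (cong (_% m) 1+i≡m) (n%n≡0 m)))

odd-cycle-not-2-colourable : ∀ {m} → ¬ 2 ∣ m → ¬ Colouring (CycAdj {m}) U 2
odd-cycle-not-2-colourable {zero} odd _ = odd (divides 0 refl)
odd-cycle-not-2-colourable {suc m} odd (c , c<2 , proper) =
  odd ([k+m]%d≡m%d⇒d∣k (suc m) c₀ 1+m+c₀≡c₀)
  where
  c₀ : ℕ
  c₀ = c zero

  c₀%2≡c₀ : c₀ % 2 ≡ c₀
  c₀%2≡c₀ = m<n⇒m%n≡m (c<2 zero _)

  alternates : ∀ k (k<1+m : k < suc m) → c (fromℕ< k<1+m) ≡ (k + c₀) % 2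
  alternates zero _ = sym c₀%2≡c₀
  alternates (suc k) 1+k<1+m =
    both≢⇒≡ (c<2 _ _) (m%n<n (suc k + c₀) 2) (m%n<n (k + c₀) 2)
      (subst (c (fromℕ< 1+k<1+m) ≢_) (alternates k k<1+m) (≢-sym (proper _ _ _ _ (inj₁ (inj₁ k→1+k)))))
      ([1+m]%2≢m%2 (k + c₀))
    where
    k<1+m : k < suc m
    k<1+m = <-trans (n<1+n k) 1+k<1+m
    k→1+k : suc (toℕ (fromℕ< k<1+m)) ≡ toℕ (fromℕ< 1+k<1+m)
    k→1+k = trans (cong suc (Fin.toℕ-fromℕ< k<1+m)) (sym (Fin.toℕ-fromℕ< 1+k<1+m))

  last≢first : (m + c₀) % 2 ≢ c₀ % 2
  last≢first eq = proper _ zero _ _ (inj₁ (inj₂ (cong suc (Fin.toℕ-fromℕ< (n<1+n m)) , refl)))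
                    (trans (alternates m (n<1+n m)) (trans eq c₀%2≡c₀))

  1+m+c₀≡c₀ : (suc m + c₀) % 2 ≡ c₀ % 2
  1+m+c₀≡c₀ = both≢⇒≡ (m%n<n (suc m + c₀) 2) (m%n<n c₀ 2) (m%n<n (m + c₀) 2)
                      ([1+m]%2≢m%2 (m + c₀)) (≢-sym last≢first)

-- Cliques and perfection

module _ {n : ℕ} {G : Graph n} where

  colouring-restrict : ∀ {P k} → Colouring G U k → Colouring G P k
  colouring-restrict (c , c<k , proper) = c , (λ v _ → c<k v _) , (λ u v _ _ → proper u v _ _)

  colouring-mono : ∀ {P k l} → k ≤ l → Colouring G P k → Colouring G P l
  colouring-mono k≤l (c , c<k , proper) = c , (λ v Pv → <-≤-trans (c<k v Pv) k≤l) , proper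

  edgeless-colouring : ∀ {P k} → ¬ Edge G P → (∀ v → P v → 0 < k) → Colouring G P k
  edgeless-colouring ¬edge 0<k = (λ _ → 0) , 0<k , λ u v Pu Pv uv → contradiction (u , v , Pu , Pv , uv) ¬edge

  perfect⇒weaklyPerfect : Perfect G → WeaklyPerfect G
  perfect⇒weaklyPerfect perfect = perfect ⊤

  clique≤colours : ∀ {S k c} → IsCliqueOfSize G S k → IsColouring G S c → k ≤ c
  clique≤colours {k = k} {c} (f , _ , f∈S , f-adj) (col , col<c , proper) = Fin.injective⇒≤ colour-injective
    where
    colour : Fin k → Fin c
    colour a = fromℕ< (col<c (f a) (f∈S a))
    colour-injective : Injective _≡_ _≡_ colour
    colour-injective {a} {b} eq with a Fin.≟ b
    ... | yes a≡b = a≡b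
    ... | no a≢b = contradiction
            (trans (sym (Fin.toℕ-fromℕ< _)) (trans (cong toℕ eq) (Fin.toℕ-fromℕ< _)))
            (proper (f a) (f b) (f∈S a) (f∈S b) (f-adj a b a≢b))

  clique∧colouring⇒cliqueEqChromatic : ∀ {S k} → IsCliqueOfSize G S k → IsColouring G S k → CliqueEqChromatic G S
  clique∧colouring⇒cliqueEqChromatic clique colouring =
    _ , (clique , λ _ clique′ → clique≤colours clique′ colouring) ,
        (colouring , λ _ colouring′ → clique≤colours clique colouring′)

  triangleFree⇒clique≤2 : ∀ {S k} → TriangleFree G → IsCliqueOfSize G S k → k ≤ 2
  triangleFree⇒clique≤2 {k = 0} _ _ = z≤n
  triangleFree⇒clique≤2 {k = 1} _ _ = s≤s z≤n
  triangleFree⇒clique≤2 {k = 2} _ _ = s≤s (s≤s z≤n)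
  triangleFree⇒clique≤2 {k = suc (suc (suc _))} triangle-free (_ , _ , _ , adj) =
    ⊥-elim (triangle-free (adj zero (suc zero) λ ()) (adj zero (suc (suc zero)) λ ())
                          (adj (suc zero) (suc (suc zero)) λ ()))

  triangleFree∧oddHole⇒¬weaklyPerfect : ∀ {m v} → TriangleFree G → IsHole G m v → ¬ 2 ∣ m → ¬ WeaklyPerfect G
  triangleFree∧oddHole⇒¬weaklyPerfect {v = v} triangle-free (_ , _ , induced) odd
                                      (k , (clique , _) , ((c , c<k , proper) , _)) =
    odd-cycle-not-2-colourable odd
      ( (λ i → c (v i))
      , (λ i _ → <-≤-trans (c<k (v i) ∈⊤) (triangleFree⇒clique≤2 triangle-free clique))
      , (λ i j _ _ ij → proper (v i) (v j) ∈⊤ ∈⊤ (proj₂ (induced i j) ij)))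

module _ {n : ℕ} {G : Graph n} (G? : ∀ u v → Dec (G u v))
         (G-irrefl : ∀ u → ¬ G u u) (G-sym : ∀ {u v} → G u v → G v u) where

  pairwise-adjacent⇒clique : ∀ {S k} (f : Fin k → Fin n) → (∀ a → f a ∈ S) →
                             (∀ a b → a ≢ b → G (f a) (f b)) → IsCliqueOfSize G S k
  pairwise-adjacent⇒clique f f∈S adj = f , f-injective , f∈S , adj
    where
    f-injective : Injective _≡_ _≡_ f
    f-injective {a} {b} eq with a Fin.≟ b
    ... | yes a≡b = a≡b
    ... | no a≢b = contradiction (subst (G (f a)) (sym eq) (adj a b a≢b)) (G-irrefl (f a))

  triangle⇒clique : ∀ {S} → Triangle G (_∈ S) → IsCliqueOfSize G S 3
  triangle⇒clique (u , v , w , u∈S , v∈S , w∈S , uv , uw , vw) = pairwise-adjacent⇒clique f f∈S adj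
    where
    f : Fin 3 → Fin n
    f zero = u
    f (suc zero) = v
    f (suc (suc zero)) = w
    f∈S : ∀ a → f a ∈ _
    f∈S zero = u∈S
    f∈S (suc zero) = v∈S
    f∈S (suc (suc zero)) = w∈S
    adj : ∀ a b → a ≢ b → G (f a) (f b)
    adj zero (suc zero) _ = uv
    adj zero (suc (suc zero)) _ = uw
    adj (suc zero) (suc (suc zero)) _ = vw
    adj (suc zero) zero _ = G-sym uv
    adj (suc (suc zero)) zero _ = G-sym uw
    adj (suc (suc zero)) (suc zero) _ = G-sym vw
    adj zero zero a≢a = contradiction refl a≢a
    adj (suc zero) (suc zero) a≢a = contradiction refl a≢a
    adj (suc (suc zero)) (suc (suc zero)) a≢a = contradiction refl a≢a

  edge⇒clique : ∀ {S} → Edge G (_∈ S) → IsCliqueOfSize G S 2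
  edge⇒clique (u , v , u∈S , v∈S , uv) = pairwise-adjacent⇒clique f f∈S adj
    where
    f : Fin 2 → Fin n
    f zero = u
    f (suc zero) = v
    f∈S : ∀ a → f a ∈ _
    f∈S zero = u∈S
    f∈S (suc zero) = v∈S
    adj : ∀ a b → a ≢ b → G (f a) (f b)
    adj zero (suc zero) _ = uv
    adj (suc zero) zero _ = G-sym uv
    adj zero zero a≢a = contradiction refl a≢a
    adj (suc zero) (suc zero) a≢a = contradiction refl a≢a

  vertex⇒clique : ∀ {S v} → v ∈ S → IsCliqueOfSize G S 1
  vertex⇒clique {v = v} v∈S = pairwise-adjacent⇒clique (λ _ → v) (λ _ → v∈S) adj
    where
    adj : ∀ (a b : Fin 1) → a ≢ b → G v v
    adj zero zero a≢a = contradiction refl a≢a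

  edge? : ∀ {P} → Decidable P → Dec (Edge G P)
  edge? P? = Fin.any? λ u → Fin.any? λ v → P? u ×-dec P? v ×-dec G? u v

  triangle? : ∀ {P} → Decidable P → Dec (Triangle G P)
  triangle? P? = Fin.any? λ u → Fin.any? λ v → Fin.any? λ w →
    P? u ×-dec P? v ×-dec P? w ×-dec G? u v ×-dec G? u w ×-dec G? v w

  -- ω(G[S]) is 3, 2, 1 or 0 according as G[S] has a triangle, an edge, a vertex or nothing,
  -- and in each case G[S] is coloured with that many colours.
  triangleFreeBipartite∧3-colourable⇒perfect : TriangleFreeBipartite G → Colouring G U 3 → Perfect G
  triangleFreeBipartite∧3-colourable⇒perfect bipartite 3-colouring S with triangle? (_∈? S)
  ... | yes t = clique∧colouring⇒cliqueEqChromatic (triangle⇒clique t) (colouring-restrict 3-colouring)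
  ... | no ¬t with edge? (_∈? S)
  ... | yes e = clique∧colouring⇒cliqueEqChromatic (edge⇒clique e) (bipartite (_∈ S) (_∈? S) ¬t)
  ... | no ¬e with Fin.any? (_∈? S)
  ... | yes (v , v∈S) = clique∧colouring⇒cliqueEqChromatic (vertex⇒clique v∈S) (edgeless-colouring ¬e λ _ _ → s≤s z≤n)
  ... | no ¬v = clique∧colouring⇒cliqueEqChromatic (pairwise-adjacent⇒clique {k = 0} (λ ()) (λ ()) λ ())
                  (edgeless-colouring ¬e λ v v∈S → contradiction (v , v∈S) ¬v)

  triangleFreeBipartite⇒oddHoleFree : TriangleFreeBipartite G → OddHoleFree G
  triangleFreeBipartite⇒oddHoleFree bipartite m v odd (4≤m , _ , induced) =
    odd-cycle-not-2-colourable odd (along-hole (bipartite OnHole on-hole? hole-triangle-free))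
    where
    OnHole : Fin n → Set
    OnHole w = ∃ λ i → v i ≡ w

    on-hole? : Decidable OnHole
    on-hole? w = Fin.any? λ i → v i Fin.≟ w

    indices-≢ : ∀ {i j} → G (v i) (v j) → i ≢ j
    indices-≢ vivj refl = G-irrefl _ vivj

    hole-triangle-free : ¬ Triangle G OnHole
    hole-triangle-free (_ , _ , _ , (i , refl) , (j , refl) , (k , refl) , ij , ik , jk) =
      cycle-triangle-free 4≤m (indices-≢ ik) (indices-≢ jk)
        (proj₁ (induced i j) ij) (proj₁ (induced i k) ik) (proj₁ (induced j k) jk)

    along-hole : Colouring G OnHole 2 → Colouring CycAdj U 2
    along-hole (c , c<2 , proper) =
      (λ i → c (v i)) , (λ i _ → c<2 (v i) (i , refl)) ,
      (λ i j _ _ ij → proper (v i) (v j) (i , refl) (j , refl) (proj₂ (induced i j) ij))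

-- Colourings of distance graphs on ℕ

∣m-n∣≡k⇒n≡m+k⊎m≡n+k : ∀ m n {k} → ∣ m - n ∣ ≡ k → n ≡ m + k ⊎ m ≡ n + k
∣m-n∣≡k⇒n≡m+k⊎m≡n+k zero n eq = inj₁ eq
∣m-n∣≡k⇒n≡m+k⊎m≡n+k (suc m) zero eq = inj₂ eq
∣m-n∣≡k⇒n≡m+k⊎m≡n+k (suc m) (suc n) eq = Sum.map (cong suc) (cong suc) (∣m-n∣≡k⇒n≡m+k⊎m≡n+k m n eq)

Step : ℕ → ℕ → ℕ → ℕ → Set
Step t₁ t₂ x y = y ≡ x + t₁ ⊎ y ≡ x + t₂

StepColouring : ℕ → ℕ → (ℕ → Set) → ℕ → Set
StepColouring t₁ t₂ Q k =
  Σ (ℕ → ℕ) λ c → (∀ x → c x < k) × (∀ {x y} → Q x → Q y → Step t₁ t₂ x y → c x ≢ c y)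

-- A step adds a or b to ⌊x/d⌋, which changes its residue mod p.
residue-colouring : ∀ {t₁ t₂ d a b p} .{{_ : NonZero d}} .{{_ : NonZero p}} →
                    t₁ ≡ a * d → t₂ ≡ b * d → ¬ p ∣ a → ¬ p ∣ b → StepColouring t₁ t₂ U p
residue-colouring {t₁} {t₂} {d} {a} {b} {p} t₁≡ad t₂≡bd p∤a p∤b =
  (λ x → (x / d) % p) , (λ x → m%n<n (x / d) p) , λ _ _ → proper
  where
  shifted : ∀ {x y k} → ¬ p ∣ k → y ≡ x + k * d → (x / d) % p ≢ (y / d) % p
  shifted {x} {k = k} p∤k refl =
    ≢-sym (subst (λ z → z % p ≢ (x / d) % p) (sym ([m+kd]/d≡k+m/d x k d)) ([k+m]%d≢m%d (x / d) p∤k))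
  proper : ∀ {x y} → Step t₁ t₂ x y → (x / d) % p ≢ (y / d) % p
  proper (inj₁ y≡x+t₁) = shifted p∤a (trans y≡x+t₁ (cong (_ +_) t₁≡ad))
  proper (inj₂ y≡x+t₂) = shifted p∤b (trans y≡x+t₂ (cong (_ +_) t₂≡bd))

module _ {s : ℕ} .{{_ : NonZero s}} {Q : ℕ → Set} (Q? : Decidable Q) where

  count : ℕ → ℕ → ℕ
  count r zero = 0
  count r (suc k) with Q? (r + k * s)
  ... | yes _ = suc (count r k)
  ... | no _ = count r k

  count-∈ : ∀ {r k} → Q (r + k * s) → count r (suc k) ≡ suc (count r k)
  count-∈ {r} {k} Qr+ks with Q? (r + k * s)
  ... | yes _ = refl
  ... | no ¬Qr+ks = contradiction Qr+ks ¬Qr+ks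

  count-∉ : ∀ {r k} → ¬ Q (r + k * s) → count r (suc k) ≡ count r k
  count-∉ {r} {k} ¬Qr+ks with Q? (r + k * s)
  ... | yes Qr+ks = contradiction Qr+ks ¬Qr+ks
  ... | no _ = refl

  -- The colour of x is the parity of the number of members of Q below x in its class mod s.
  -- Neighbours at distance s are consecutive members of the class; at distance 2s they are too,
  -- because the point between them is not in Q.
  no-three-in-a-row⇒2-colourable : (∀ x → Q x → Q (x + 1 * s) → Q (x + 2 * s) → ⊥) →
                                   StepColouring (1 * s) (2 * s) Q 2
  no-three-in-a-row⇒2-colourable no-three = colour , (λ x → m%n<n (count (x % s) (x / s)) 2) , proper
    where
    colour : ℕ → ℕ
    colour x = count (x % s) (x / s) % 2

    shift : ∀ x k → colour (x + k * s) ≡ count (x % s) (k + x / s) % 2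
    shift x k = cong₂ (λ r j → count r j % 2) ([m+kn]%n≡m%n x k s) ([m+kd]/d≡k+m/d x k s)

    position : ∀ x k → x % s + (k + x / s) * s ≡ x + k * s
    position x k = begin
      x % s + (k + x / s) * s     ≡⟨ cong (x % s +_) (*-distribʳ-+ s k (x / s)) ⟩
      x % s + (k * s + x / s * s) ≡⟨ x∙yz≈xz∙y (x % s) (k * s) (x / s * s) ⟩
      x % s + x / s * s + k * s   ≡⟨ cong (_+ k * s) (m≡m%n+[m/n]*n x s) ⟨
      x + k * s                   ∎
      where open ≡-Reasoning

    counted : ∀ {x} → Q x → count (x % s) (suc (x / s)) ≡ suc (count (x % s) (x / s))
    counted {x} Qx = count-∈ (subst Q (m≡m%n+[m/n]*n x s) Qx)

    flipped : ∀ {x y} → colour y ≡ suc (count (x % s) (x / s)) % 2 → colour x ≢ colour y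
    flipped {x} eq = ≢-sym (subst (_≢ colour x) (sym eq) ([1+m]%2≢m%2 (count (x % s) (x / s))))

    proper : ∀ {x y} → Q x → Q y → Step (1 * s) (2 * s) x y → colour x ≢ colour y
    proper {x} Qx _ (inj₁ refl) = flipped (trans (shift x 1) (cong (_% 2) (counted Qx)))
    proper {x} Qx Qy (inj₂ refl) = flipped (trans (shift x 2) (cong (_% 2) (trans (count-∉ ¬Qx+s) (counted Qx))))
      where
      ¬Qx+s : ¬ Q (x % s + (1 + x / s) * s)
      ¬Qx+s Qx+s = no-three x Qx (subst Q (position x 1) Qx+s) Qy

-- Toeplitz graphs

module Toeplitz (n t₁ t₂ : ℕ) where

  G : Graph n
  G = Toeplitz₂ n t₁ t₂

  adjacent? : ∀ u v → Dec (G u v)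
  adjacent? u v = ¬? (u Fin.≟ v) ×-dec ((∣ toℕ u - toℕ v ∣ ≟ t₁) ⊎-dec (∣ toℕ u - toℕ v ∣ ≟ t₂))

  adjacent-irrefl : ∀ u → ¬ G u u
  adjacent-irrefl u (u≢u , _) = u≢u refl

  adjacent-sym : ∀ {u v} → G u v → G v u
  adjacent-sym {u} {v} (u≢v , dist) = ≢-sym u≢v , Sum.map (trans ∣v-u∣≡∣u-v∣) (trans ∣v-u∣≡∣u-v∣) dist
    where
    ∣v-u∣≡∣u-v∣ : ∣ toℕ v - toℕ u ∣ ≡ ∣ toℕ u - toℕ v ∣
    ∣v-u∣≡∣u-v∣ = ∣-∣-comm (toℕ v) (toℕ u)

  adjacent⇒step : ∀ {u v} → G u v → Step t₁ t₂ (toℕ u) (toℕ v) ⊎ Step t₁ t₂ (toℕ v) (toℕ u)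
  adjacent⇒step {u} {v} (_ , inj₁ dist) = Sum.map inj₁ inj₁ (∣m-n∣≡k⇒n≡m+k⊎m≡n+k (toℕ u) (toℕ v) dist)
  adjacent⇒step {u} {v} (_ , inj₂ dist) = Sum.map inj₂ inj₂ (∣m-n∣≡k⇒n≡m+k⊎m≡n+k (toℕ u) (toℕ v) dist)

  at-distance⇒adjacent : ∀ {t} {u v : Fin n} → 1 ≤ t → toℕ v ≡ toℕ u + t → u ≢ v × ∣ toℕ u - toℕ v ∣ ≡ t
  at-distance⇒adjacent {t} {u} (s≤s _) v≡u+t =
    (λ { refl → m+1+n≢m _ (sym v≡u+t) }) , trans (cong (∣ toℕ u -_∣) v≡u+t) (∣m-m+n∣≡n (toℕ u) t)

  step⇒adjacent : 1 ≤ t₁ → 1 ≤ t₂ → ∀ {u v} → Step t₁ t₂ (toℕ u) (toℕ v) → G u v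
  step⇒adjacent 1≤t₁ _ (inj₁ v≡u+t₁) = Product.map₂ inj₁ (at-distance⇒adjacent 1≤t₁ v≡u+t₁)
  step⇒adjacent _ 1≤t₂ (inj₂ v≡u+t₂) = Product.map₂ inj₂ (at-distance⇒adjacent 1≤t₂ v≡u+t₂)

  step-colouring⇒colouring : ∀ {Q P k} → StepColouring t₁ t₂ Q k → (∀ v → P v → Q (toℕ v)) → Colouring G P k
  step-colouring⇒colouring (c , c<k , proper) P⊆Q =
    (λ v → c (toℕ v)) , (λ v _ → c<k (toℕ v)) ,
    λ u v u∈P v∈P uv → [ proper (P⊆Q u u∈P) (P⊆Q v v∈P) , (λ vu → ≢-sym (proper (P⊆Q v v∈P) (P⊆Q u u∈P) vu)) ]
                       (adjacent⇒step uv)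

  module _ (1≤t₁ : 1 ≤ t₁) (t₁<t₂ : t₁ < t₂) where

    private
      0<t₂ : 0 < t₂
      0<t₂ = <-trans 1≤t₁ t₁<t₂

      Length : ℕ → Set
      Length e = e ≡ t₁ ⊎ e ≡ t₂

      step-length : ∀ {x y} → Step t₁ t₂ x y → ∃ λ e → Length e × y ≡ x + e
      step-length (inj₁ y≡x+t₁) = t₁ , inj₁ refl , y≡x+t₁
      step-length (inj₂ y≡x+t₂) = t₂ , inj₂ refl , y≡x+t₂

      sum-of-lengths : ∀ {e₁ e₂ e₃} → Length e₁ → Length e₂ → Length e₃ → e₁ + e₂ ≡ e₃ → t₂ ≡ t₁ + t₁
      sum-of-lengths (inj₁ refl) (inj₁ refl) (inj₂ refl) eq = sym eq
      sum-of-lengths (inj₁ refl) (inj₁ refl) (inj₁ refl) eq = contradiction eq (>⇒≢ (m<m+n t₁ 1≤t₁))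
      sum-of-lengths (inj₁ refl) (inj₂ refl) (inj₁ refl) eq = contradiction eq (>⇒≢ (m<m+n t₁ 0<t₂))
      sum-of-lengths (inj₁ refl) (inj₂ refl) (inj₂ refl) eq = contradiction eq (>⇒≢ (m<n+m t₂ 1≤t₁))
      sum-of-lengths (inj₂ refl) (inj₁ refl) (inj₁ refl) eq = contradiction eq (>⇒≢ (m<n+m t₁ 0<t₂))
      sum-of-lengths (inj₂ refl) (inj₁ refl) (inj₂ refl) eq = contradiction eq (>⇒≢ (m<m+n t₂ 1≤t₁))
      sum-of-lengths (inj₂ refl) (inj₂ refl) (inj₁ refl) eq = contradiction eq (>⇒≢ (<-≤-trans t₁<t₂ (m≤m+n t₂ t₂)))
      sum-of-lengths (inj₂ refl) (inj₂ refl) (inj₂ refl) eq = contradiction eq (>⇒≢ (m<m+n t₂ 0<t₂))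

      transitive-steps : ∀ {x y z} → Step t₁ t₂ x y → Step t₁ t₂ y z → Step t₁ t₂ x z → t₂ ≡ t₁ + t₁
      transitive-steps {x} xy yz xz with step-length xy | step-length yz | step-length xz
      ... | e₁ , ℓ₁ , refl | e₂ , ℓ₂ , refl | e₃ , ℓ₃ , z≡x+e₃ =
        sum-of-lengths ℓ₁ ℓ₂ ℓ₃ (+-cancelˡ-≡ x _ _ (trans (sym (+-assoc x e₁ e₂)) z≡x+e₃))

      step-increasing : ∀ {x y} → Step t₁ t₂ x y → x < y
      step-increasing (inj₁ refl) = m<m+n _ 1≤t₁
      step-increasing (inj₂ refl) = m<m+n _ 0<t₂

      cyclic-steps : ∀ {x y z} → Step t₁ t₂ x y → Step t₁ t₂ y z → Step t₁ t₂ z x → ⊥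
      cyclic-steps xy yz zx =
        <-irrefl refl (<-trans (step-increasing xy) (<-trans (step-increasing yz) (step-increasing zx)))

    -- Orient each edge of the triangle upwards: either the orientation is transitive, so one
    -- length is the sum of the other two, or it is cyclic, which is absurd.
    triangle⇒t₂≡t₁+t₁ : ∀ {u v w} → G u v → G u w → G v w → t₂ ≡ t₁ + t₁
    triangle⇒t₂≡t₁+t₁ uv uw vw with adjacent⇒step uv | adjacent⇒step uw | adjacent⇒step vw
    ... | inj₁ u→v | inj₁ u→w | inj₁ v→w = transitive-steps u→v v→w u→w
    ... | inj₁ u→v | inj₁ u→w | inj₂ w→v = transitive-steps u→w w→v u→v
    ... | inj₁ u→v | inj₂ w→u | inj₁ v→w = ⊥-elim (cyclic-steps u→v v→w w→u)
    ... | inj₁ u→v | inj₂ w→u | inj₂ w→v = transitive-steps w→u u→v w→v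
    ... | inj₂ v→u | inj₁ u→w | inj₁ v→w = transitive-steps v→u u→w v→w
    ... | inj₂ v→u | inj₁ u→w | inj₂ w→v = ⊥-elim (cyclic-steps v→u u→w w→v)
    ... | inj₂ v→u | inj₂ w→u | inj₁ v→w = transitive-steps v→w w→u v→u
    ... | inj₂ v→u | inj₂ w→u | inj₂ w→v = transitive-steps w→v v→u w→u

module _ {n d : ℕ} .{{_ : NonZero d}} where

  odd-multiples-perfect∧oddHoleFree : ∀ {a b} → ¬ 2 ∣ a → ¬ 2 ∣ b →
    Perfect (Toeplitz₂ n (a * d) (b * d)) × OddHoleFree (Toeplitz₂ n (a * d) (b * d))
  odd-multiples-perfect∧oddHoleFree {a} {b} 2∤a 2∤b =
    triangleFreeBipartite∧3-colourable⇒perfect adjacent? adjacent-irrefl adjacent-sym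
      (λ _ _ _ → colouring-restrict 2-colouring) (colouring-mono (n≤1+n 2) 2-colouring) ,
    triangleFreeBipartite⇒oddHoleFree adjacent? adjacent-irrefl adjacent-sym (λ _ _ _ → colouring-restrict 2-colouring)
    where
    open Toeplitz n (a * d) (b * d)
    2-colouring : Colouring G U 2
    2-colouring = step-colouring⇒colouring (residue-colouring refl refl 2∤a 2∤b) (λ _ _ → _)

  1-2-multiples-perfect∧oddHoleFree :
    Perfect (Toeplitz₂ n (1 * d) (2 * d)) × OddHoleFree (Toeplitz₂ n (1 * d) (2 * d))
  1-2-multiples-perfect∧oddHoleFree =
    triangleFreeBipartite∧3-colourable⇒perfect adjacent? adjacent-irrefl adjacent-sym
      triangle-free-bipartite 3-colouring ,
    triangleFreeBipartite⇒oddHoleFree adjacent? adjacent-irrefl adjacent-sym triangle-free-bipartite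
    where
    open Toeplitz n (1 * d) (2 * d)

    3-colouring : Colouring G U 3
    3-colouring =
      step-colouring⇒colouring (residue-colouring refl refl (>⇒∤ (s≤s (s≤s z≤n))) (>⇒∤ ≤-refl)) (λ _ _ → _)

    triangle-free-bipartite : TriangleFreeBipartite G
    triangle-free-bipartite P P? no-triangle =
      step-colouring⇒colouring (no-three-in-a-row⇒2-colourable Q? no-three) (λ v Pv → v , Pv , refl)
      where
      Q : ℕ → Set
      Q x = ∃ λ v → P v × toℕ v ≡ x
      Q? : Decidable Q
      Q? x = Fin.any? λ v → P? v ×-dec (toℕ v ≟ x)
      1≤d : 1 ≤ 1 * d
      1≤d = subst (1 ≤_) (sym (*-identityˡ d)) (>-nonZero⁻¹ d)
      1≤2d : 1 ≤ 2 * d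
      1≤2d = ≤-trans 1≤d (*-monoˡ-≤ d (n≤1+n 1))
      no-three : ∀ x → Q x → Q (x + 1 * d) → Q (x + 2 * d) → ⊥
      no-three x (u , Pu , refl) (v , Pv , v≡u+d) (w , Pw , w≡u+2d) =
        no-triangle (u , v , w , Pu , Pv , Pw ,
                     adjacent (inj₁ v≡u+d) , adjacent (inj₂ w≡u+2d) , adjacent (inj₁ w≡v+d))
        where
        adjacent : ∀ {u v} → Step (1 * d) (2 * d) (toℕ u) (toℕ v) → G u v
        adjacent = step⇒adjacent 1≤d 1≤2d
        w≡v+d : toℕ w ≡ toℕ v + 1 * d
        w≡v+d = begin
          toℕ w                   ≡⟨ w≡u+2d ⟩
          toℕ u + 2 * d           ≡⟨ cong (toℕ u +_) (*-distribʳ-+ d 1 1) ⟩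
          toℕ u + (1 * d + 1 * d) ≡⟨ +-assoc (toℕ u) (1 * d) (1 * d) ⟨
          toℕ u + 1 * d + 1 * d   ≡⟨ cong (_+ 1 * d) v≡u+d ⟨
          toℕ v + 1 * d           ∎
          where open ≡-Reasoning

-- The odd hole

module OddHole {n d a b : ℕ} .{{_ : NonZero d}} .{{_ : NonZero (a + b)}} (1≤a : 1 ≤ a) (1≤b : 1 ≤ b)
               (coprime : Coprime (a + b) a) (4≤q : 4 ≤ a + b) (qd≤n : (a + b) * d ≤ n) where

  open Toeplitz n (a * d) (b * d)

  q : ℕ
  q = a + b

  residue : Fin q → ℕ
  residue i = (toℕ i * a) % q

  residue<q : ∀ i → residue i < q
  residue<q i = m%n<n (toℕ i * a) q

  vertex : Fin q → Fin n
  vertex i = fromℕ< (<-≤-trans (*-monoˡ-< d (residue<q i)) qd≤n)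

  toℕ-vertex : ∀ i → toℕ (vertex i) ≡ residue i * d
  toℕ-vertex i = Fin.toℕ-fromℕ< _

  toℕ%q : ∀ (i : Fin q) → toℕ i % q ≡ toℕ i
  toℕ%q i = m<n⇒m%n≡m (Fin.toℕ<n i)

  vertex-injective : Injective _≡_ _≡_ vertex
  vertex-injective {i} {j} vi≡vj = Fin.toℕ-injective (begin
    toℕ i     ≡⟨ toℕ%q i ⟨
    toℕ i % q ≡⟨ %-cancelʳ-* coprime ri≡rj ⟩
    toℕ j % q ≡⟨ toℕ%q j ⟩
    toℕ j     ∎)
    where
    open ≡-Reasoning
    ri≡rj : residue i ≡ residue j
    ri≡rj = *-cancelʳ-≡ (residue i) (residue j) d
              (trans (sym (toℕ-vertex i)) (trans (cong toℕ vi≡vj) (toℕ-vertex j)))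

  residue-next : ∀ i → (residue i + a) % q ≡ (suc (toℕ i) * a) % q
  residue-next i = trans ([m%d+n]%d≡[m+n]%d (toℕ i * a) a q) (cong (_% q) (+-comm (toℕ i * a) a))

  CycSucc⇒residue : ∀ {i j} → CycSucc i j → residue j ≡ (residue i + a) % q
  CycSucc⇒residue {i} {j} i→j = trans (%-congʳ-* a q j≡1+i) (sym (residue-next i))
    where
    j≡1+i : toℕ j % q ≡ suc (toℕ i) % q
    j≡1+i = trans (cong (_% q) (CycSucc⇒≡suc-mod i→j)) (m%n%n≡m%n (suc (toℕ i)) q)

  residue⇒CycSucc : ∀ {i j} → residue j ≡ (residue i + a) % q → CycSucc i j
  residue⇒CycSucc {i} {j} rj≡ =
    ≡suc-mod⇒CycSucc (trans (sym (toℕ%q j)) (%-cancelʳ-* coprime (trans rj≡ (residue-next i))))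

  vertex-shift : ∀ i k → toℕ (vertex i) + k * d ≡ (residue i + k) * d
  vertex-shift i k = trans (cong (_+ k * d) (toℕ-vertex i)) (sym (*-distribʳ-+ d (residue i) k))

  scale : ∀ {i j k} → residue j ≡ residue i + k → toℕ (vertex j) ≡ toℕ (vertex i) + k * d
  scale {i} {j} {k} rj≡ = trans (toℕ-vertex j) (trans (cong (_* d) rj≡) (sym (vertex-shift i k)))

  unscale : ∀ {i j k} → toℕ (vertex j) ≡ toℕ (vertex i) + k * d → residue j ≡ residue i + k
  unscale {i} {j} {k} vj≡ =
    *-cancelʳ-≡ (residue j) (residue i + k) d (trans (sym (toℕ-vertex j)) (trans vj≡ (vertex-shift i k)))

  rotation⇒CycSucc : ∀ {i j} → residue j ≡ residue i + a ⊎ residue j + b ≡ residue i → CycSucc i j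
  rotation⇒CycSucc {j = j} rotation = residue⇒CycSucc (y≡x+a⊎y+b≡x⇒y≡[x+a]%[a+b] {a} {b} (residue<q j) rotation)

  adjacent⇒CycAdj : ∀ {i j} → G (vertex i) (vertex j) → CycAdj i j
  adjacent⇒CycAdj {i} {j} vivj with adjacent⇒step vivj
  ... | inj₁ (inj₁ vj≡vi+ad) = inj₁ (rotation⇒CycSucc (inj₁ (unscale {i} {j} vj≡vi+ad)))
  ... | inj₁ (inj₂ vj≡vi+bd) = inj₂ (rotation⇒CycSucc (inj₂ (sym (unscale {i} {j} vj≡vi+bd))))
  ... | inj₂ (inj₁ vi≡vj+ad) = inj₂ (rotation⇒CycSucc (inj₁ (unscale {j} {i} vi≡vj+ad)))
  ... | inj₂ (inj₂ vi≡vj+bd) = inj₁ (rotation⇒CycSucc (inj₂ (sym (unscale {j} {i} vi≡vj+bd))))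

  1≤ad : 1 ≤ a * d
  1≤ad = *-mono-≤ 1≤a (>-nonZero⁻¹ d)

  1≤bd : 1 ≤ b * d
  1≤bd = *-mono-≤ 1≤b (>-nonZero⁻¹ d)

  CycSucc⇒adjacent : ∀ {i j} → CycSucc i j → G (vertex i) (vertex j)
  CycSucc⇒adjacent {i} {j} i→j
    with y≡[x+a]%[a+b]⇒y≡x+a⊎y+b≡x {a} {b} (residue<q i) (residue<q j) (CycSucc⇒residue i→j)
  ... | inj₁ rj≡ri+a = step⇒adjacent 1≤ad 1≤bd (inj₁ (scale {i} {j} rj≡ri+a))
  ... | inj₂ rj+b≡ri = adjacent-sym (step⇒adjacent 1≤ad 1≤bd (inj₂ (scale {j} {i} (sym rj+b≡ri))))

  hole : IsHole G q vertex
  hole = 4≤q , vertex-injective ,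
         λ i j → adjacent⇒CycAdj , [ CycSucc⇒adjacent , (λ j→i → adjacent-sym (CycSucc⇒adjacent j→i)) ]

-- Reduction by the gcd

m<n∧m+n≡3⇒m≡1∧n≡2 : ∀ {m n} → 1 ≤ m → m < n → m + n ≡ 3 → m ≡ 1 × n ≡ 2
m<n∧m+n≡3⇒m≡1∧n≡2 {suc m} {suc (suc n)} (s≤s z≤n) (s≤s (s≤s _)) eq =
  cong suc (m+n≡0⇒m≡0 m m+n≡0) , cong (λ k → suc (suc k)) (m+n≡0⇒n≡0 m m+n≡0)
  where
  m+n≡0 : m + n ≡ 0
  m+n≡0 = suc-injective (suc-injective
            (trans (sym (trans (+-suc m (suc n)) (cong suc (+-suc m n)))) (suc-injective eq)))

module GcdReduction (t₁ t₂ : ℕ) (1≤t₁ : 1 ≤ t₁) (t₁<t₂ : t₁ < t₂) where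

  d : ℕ
  d = gcd t₁ t₂

  instance
    d≢0 : NonZero d
    d≢0 = ≢-nonZero (gcd[m,n]≢0 t₁ t₂ (inj₁ (≢-sym (<⇒≢ 1≤t₁))))

  a : ℕ
  a = t₁ / d

  b : ℕ
  b = t₂ / d

  q : ℕ
  q = a + b

  t₁≡ad : t₁ ≡ a * d
  t₁≡ad = sym (m/n*n≡m (gcd[m,n]∣m t₁ t₂))

  t₂≡bd : t₂ ≡ b * d
  t₂≡bd = sym (m/n*n≡m (gcd[m,n]∣n t₁ t₂))

  coprime : Coprime a b
  coprime = coprime-/gcd t₁ t₂

  1≤a : 1 ≤ a
  1≤a = n≢0⇒n>0 λ a≡0 → <⇒≢ 1≤t₁ (sym (trans t₁≡ad (cong (_* d) a≡0)))

  a<b : a < b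
  a<b = *-cancelʳ-< d a b (subst₂ _<_ t₁≡ad t₂≡bd t₁<t₂)

  1≤b : 1 ≤ b
  1≤b = ≤-trans 1≤a (<⇒≤ a<b)

  3≤q : 3 ≤ q
  3≤q = +-mono-≤ 1≤a (≤-trans (s≤s 1≤a) a<b)

  instance
    q≢0 : NonZero q
    q≢0 = >-nonZero (≤-trans (s≤s z≤n) 3≤q)

  t₁+t₂≡dq : t₁ + t₂ ≡ d * q
  t₁+t₂≡dq = trans (cong₂ _+_ t₁≡ad t₂≡bd) (trans (sym (*-distribʳ-+ d a b)) (*-comm q d))

  QuotCond⇔even∨3 : QuotCond t₁ t₂ ⇔ (2 ∣ q ⊎ q ≡ 3)
  QuotCond⇔even∨3 = mk⇔
    (λ (q′ , t₁+t₂≡dq′ , cond) →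
       subst (λ k → 2 ∣ k ⊎ k ≡ 3) (*-cancelˡ-≡ q′ q d (trans (sym t₁+t₂≡dq′) t₁+t₂≡dq)) cond)
    (λ cond → q , t₁+t₂≡dq , cond)

  even⇒odd-parts : 2 ∣ q → ¬ 2 ∣ a × ¬ 2 ∣ b
  even⇒odd-parts 2∣q =
    (λ 2∣a → contradiction (coprime (2∣a , ∣m+n∣m⇒∣n 2∣q 2∣a)) λ ()) ,
    (λ 2∣b → contradiction (coprime (∣m+n∣m⇒∣n (subst (2 ∣_) (+-comm a b) 2∣q) 2∣b , 2∣b)) λ ())

  q≡3⇒a≡1∧b≡2 : q ≡ 3 → a ≡ 1 × b ≡ 2
  q≡3⇒a≡1∧b≡2 = m<n∧m+n≡3⇒m≡1∧n≡2 1≤a a<b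

  q≢3⇒4≤q : q ≢ 3 → 4 ≤ q
  q≢3⇒4≤q q≢3 = ≤∧≢⇒< 3≤q (≢-sym q≢3)

  coprime-q-a : Coprime q a
  coprime-q-a (i∣q , i∣a) = coprime (i∣a , ∣m+n∣m⇒∣n i∣q i∣a)

  qd≤n : ∀ {n} → t₁ + t₂ ≤ n → q * d ≤ n
  qd≤n {n} = subst (_≤ n) (trans t₁+t₂≡dq (*-comm d q))

  t₂≡t₁+t₁⇒q≡3 : t₂ ≡ t₁ + t₁ → q ≡ 3
  t₂≡t₁+t₁⇒q≡3 t₂≡2t₁ = trans (cong (a +_) b≡2) (cong (_+ 2) a≡1)
    where
    b≡a+a : b ≡ a + a
    b≡a+a = *-cancelʳ-≡ b (a + a) d
              (trans (sym t₂≡bd) (trans t₂≡2t₁ (trans (cong₂ _+_ t₁≡ad t₁≡ad) (sym (*-distribʳ-+ d a a)))))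
    a≡1 : a ≡ 1
    a≡1 = coprime (∣-refl , divides 2 (trans b≡a+a (cong (a +_) (sym (+-identityʳ a)))))
    b≡2 : b ≡ 2
    b≡2 = trans b≡a+a (cong₂ _+_ a≡1 a≡1)

module _ {Q O P W : Set} (P⇒W : P → W) where

  all-equivalent-if-true : Q → P × O → (Q ⇔ O) × (Q ⇔ P) × (Q ⇔ W)
  all-equivalent-if-true q (p , o) =
    mk⇔ (λ _ → o) (λ _ → q) , mk⇔ (λ _ → p) (λ _ → q) , mk⇔ (λ _ → P⇒W p) (λ _ → q)

  all-equivalent-if-false : ¬ Q → ¬ O → ¬ W → (Q ⇔ O) × (Q ⇔ P) × (Q ⇔ W)
  all-equivalent-if-false ¬q ¬o ¬w =
    mk⇔ (⊥-elim ∘ ¬q) (⊥-elim ∘ ¬o) , mk⇔ (⊥-elim ∘ ¬q) (⊥-elim ∘ ¬w ∘ P⇒W) , mk⇔ (⊥-elim ∘ ¬q) (⊥-elim ∘ ¬w)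

module Classification (n t₁ t₂ : ℕ) (1≤t₁ : 1 ≤ t₁) (t₁<t₂ : t₁ < t₂) (t₁+t₂≤n : t₁ + t₂ ≤ n) where

  open GcdReduction t₁ t₂ 1≤t₁ t₁<t₂ public

  G : Graph n
  G = Toeplitz₂ n t₁ t₂

  PerfectAndOddHoleFree : ℕ → ℕ → Set
  PerfectAndOddHoleFree x y = Perfect (Toeplitz₂ n x y) × OddHoleFree (Toeplitz₂ n x y)

  even⇒perfect∧oddHoleFree : 2 ∣ q → Perfect G × OddHoleFree G
  even⇒perfect∧oddHoleFree 2∣q =
    subst₂ PerfectAndOddHoleFree (sym t₁≡ad) (sym t₂≡bd)
      (odd-multiples-perfect∧oddHoleFree (proj₁ (even⇒odd-parts 2∣q)) (proj₂ (even⇒odd-parts 2∣q)))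

  3⇒perfect∧oddHoleFree : q ≡ 3 → Perfect G × OddHoleFree G
  3⇒perfect∧oddHoleFree q≡3 =
    subst₂ PerfectAndOddHoleFree
      (sym (trans t₁≡ad (cong (_* d) (proj₁ (q≡3⇒a≡1∧b≡2 q≡3)))))
      (sym (trans t₂≡bd (cong (_* d) (proj₂ (q≡3⇒a≡1∧b≡2 q≡3)))))
      1-2-multiples-perfect∧oddHoleFree

  module _ (q≢3 : q ≢ 3) where

    vertex : Fin q → Fin n
    vertex = OddHole.vertex {n} 1≤a 1≤b coprime-q-a (q≢3⇒4≤q q≢3) (qd≤n t₁+t₂≤n)

    hole : IsHole G q vertex
    hole = subst₂ (λ x y → IsHole (Toeplitz₂ n x y) q vertex) (sym t₁≡ad) (sym t₂≡bd)
             (OddHole.hole 1≤a 1≤b coprime-q-a (q≢3⇒4≤q q≢3) (qd≤n t₁+t₂≤n))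

    triangle-free : TriangleFree G
    triangle-free uv uw vw = q≢3 (t₂≡t₁+t₁⇒q≡3 (Toeplitz.triangle⇒t₂≡t₁+t₁ n t₁ t₂ 1≤t₁ t₁<t₂ uv uw vw))

theorem17 : (n t₁ t₂ : ℕ) → 1 ≤ t₁ → t₁ < t₂ → t₂ < n → t₁ + t₂ ≤ n →
    (QuotCond t₁ t₂ ⇔ OddHoleFree (Toeplitz₂ n t₁ t₂)) ×
    (QuotCond t₁ t₂ ⇔ Perfect (Toeplitz₂ n t₁ t₂)) ×
    (QuotCond t₁ t₂ ⇔ WeaklyPerfect (Toeplitz₂ n t₁ t₂))
-- The hypothesis t₂ < n is implied by t₁ + t₂ ≤ n.
theorem17 n t₁ t₂ 1≤t₁ t₁<t₂ _ t₁+t₂≤n = by-cases (2 ∣? q) (q ≟ 3)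
  where
  open Classification n t₁ t₂ 1≤t₁ t₁<t₂ t₁+t₂≤n
  by-cases : Dec (2 ∣ q) → Dec (q ≡ 3) →
    (QuotCond t₁ t₂ ⇔ OddHoleFree G) × (QuotCond t₁ t₂ ⇔ Perfect G) × (QuotCond t₁ t₂ ⇔ WeaklyPerfect G)
  by-cases (yes 2∣q) _ =
    all-equivalent-if-true perfect⇒weaklyPerfect
      (Equivalence.from QuotCond⇔even∨3 (inj₁ 2∣q)) (even⇒perfect∧oddHoleFree 2∣q)
  by-cases (no _) (yes q≡3) =
    all-equivalent-if-true perfect⇒weaklyPerfect
      (Equivalence.from QuotCond⇔even∨3 (inj₂ q≡3)) (3⇒perfect∧oddHoleFree q≡3)
  by-cases (no 2∤q) (no q≢3) =
    all-equivalent-if-false perfect⇒weaklyPerfect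
      (λ cond → [ 2∤q , q≢3 ] (Equivalence.to QuotCond⇔even∨3 cond))
      (λ odd-hole-free → odd-hole-free q (vertex q≢3) 2∤q (hole q≢3))
      (triangleFree∧oddHole⇒¬weaklyPerfect (triangle-free q≢3) (hole q≢3) 2∤q)
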